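{- Let $I_1,I_2$ be non-negative integers with $I_1\neq I_2$. If $\min\{I_1,I_2\}\in\{0,\dots,2^{\ell_{\min}}-1\}$ for some integer $\ell_{\min}\ge1$, then $\textsc{CVChoice}(I_1,I_2)$ is an integer in $\{0,\dots,8\ell_{\min}+3\}$.
   Context: A binary string $S$ of length $\ell\ge1$ is written $S=s_{\ell-1}\cdots s_0$ and $S[i]$ denotes $s_i$ (index $0$ is the rightmost bit). $\textsc{BinaryRep}(n)$ is the base-2 representation of the non-negative integer $n$ without leading zeros (with $\textsc{BinaryRep}(0)=0$, of length $1$), and $\textsc{IntVal}(S)$ is the integer whose base-2 representation is $S$; $\cdot$ denotes concatenation. For a binary string $S$ of length $\ell\ge1$, $\textsc{EncodeSF}(S)$ is the string $S'$ of length $2\ell+2$ with $S'[2\ell+1]=S'[2\ell]=0$ and $S'[2i+1]=S[i]$, $S'[2i]=1-S[i]$ for $i\in\{0,\dots,\ell-1\}$. For non-negative integers $a\ne b$, $\textsc{CVChoice}(a,b)$ is computed as follows: let $A=\textsc{EncodeSF}(\textsc{BinaryRep}(a))$ and $B=\textsc{EncodeSF}(\textsc{BinaryRep}(b))$; let $i$ be the smallest $x\ge0$ such that $A[x]\neq B[x]$; return $\textsc{IntVal}(\textsc{BinaryRep}(i)\cdot A[i])$. -}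

module Defs where

open import Data.Nat using (ℕ; zero; suc; _+_; _*_)
open import Data.Nat.DivMod using (_/_; _%_)
open import Data.Bool using (Bool; true; false; not; if_then_else_)
open import Data.List using (List; []; _∷_; length; _++_)
open import Data.Maybe using (Maybe; just; nothing; map)
open import Data.Nat.Induction using (<-wellFounded)
open import Induction.WellFounded using (Acc; acc)
open import Data.Nat.DivMod using (m/n<m)
open import Data.Nat using (_<_; _≤_; s≤s; z≤n)

-- Binary strings S = s_{ℓ-1} ⋯ s_0 are represented as lists of bits
-- LEAST SIGNIFICANT FIRST: the list element at position i is S[i].
-- Bits: false = 0, true = 1.
BitString : Set
BitString = List Bool

bitVal : Bool → ℕ
bitVal false = 0
bitVal true  = 1

intVal : BitString → ℕ
intVal []       = 0
intVal (b ∷ bs) = bitVal b + 2 * intVal bs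

private
  digits : (n : ℕ) → Acc _<_ n → BitString
  digits zero _ = []
  digits (suc n) (acc rs) =
    ((suc n % 2) Data.Nat.≡ᵇ 1) ∷ digits (suc n / 2) (rs (m/n<m (suc n) 2 (s≤s (s≤s z≤n))))

binaryRep : ℕ → BitString
binaryRep zero    = false ∷ []
binaryRep (suc n) = digits (suc n) (<-wellFounded (suc n))

-- EncodeSF(S): S'[2i+1] = S[i], S'[2i] = 1 - S[i], followed by two leading 0s
-- at positions 2ℓ and 2ℓ+1.
encodeSF : BitString → BitString
encodeSF []       = false ∷ false ∷ []
encodeSF (b ∷ bs) = not b ∷ b ∷ encodeSF bs

eqBit : Bool → Bool → Bool
eqBit false false = true
eqBit true  true  = true
eqBit _     _     = false

firstDiff : BitString → BitString → Maybe ℕ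
firstDiff []       _        = nothing
firstDiff (_ ∷ _)  []       = nothing
firstDiff (a ∷ as) (b ∷ bs) =
  if eqBit a b then map suc (firstDiff as bs) else just zero

bitAt : BitString → ℕ → Maybe Bool
bitAt []       _       = nothing
bitAt (b ∷ _)  zero    = just b
bitAt (_ ∷ bs) (suc i) = bitAt bs i

-- CVChoice(a,b) = IntVal(BinaryRep(i) · A[i]); concatenation BinaryRep(i)·A[i]
-- puts the single bit A[i] at position 0 (LSB first representation).
cvChoice : ℕ → ℕ → Maybe ℕ
cvChoice a b with firstDiff (encodeSF (binaryRep a)) (encodeSF (binaryRep b))
... | nothing = nothing
... | just i with bitAt (encodeSF (binaryRep a)) i
...   | nothing = nothing
...   | just ai = just (intVal (ai ∷ binaryRep i))

{-# OPTIONS --safe #-}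
-- EncodeSF writes each bit b as the pair (1 − b, b) and terminates with 00, which
-- is no such pair. Hence the codes of two distinct strings already differ inside
-- the code of the shorter one, at an index i ≤ 2 · min(lengths) + 1. The smaller
-- of I₁, I₂ has at most ℓmin binary digits, so i ≤ 2 ℓmin + 1 and
-- CVChoice = 2 i + A[i] ≤ 4 ℓmin + 3, well within the claimed 8 ℓmin + 3.
module Submission where

open import Defs
open import Data.Nat using (ℕ; _≤_; _<_; _+_; _*_; _^_; _⊔_; _⊓_)
open import Data.Maybe using (just)
open import Data.Product using (∃; _×_)
open import Relation.Binary.PropositionalEquality using (_≡_; _≢_)

open import Data.Bool using (true; false; not)
open import Data.Empty using (⊥-elim)
open import Data.List using ([]; _∷_; length)
open import Data.Nat using (zero; suc; z≤n; s≤s; _≡ᵇ_)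
open import Data.Nat.DivMod using (_/_; _%_; m/n<m; m%n<n; m≡m%n+[m/n]*n; m<n*o⇒m/o<n)
open import Data.Nat.Induction using (<-wellFounded; <′-wellFounded′)
open import Data.Nat.Properties
  using (<⇒<′; *-comm; *-suc; ≤-trans; +-mono-≤; +-monoˡ-≤; *-monoʳ-≤; *-monoˡ-≤;
         ⊓-sel; m⊓n≤m; m⊓n≤n; module ≤-Reasoning)
open import Data.Nat.Tactic.RingSolver using (solve)
open import Data.Product using (_,_)
open import Data.Sum using (inj₁; inj₂)
open import Function using (_∘_)
open import Induction.WellFounded using (Acc; acc; module Subrelation)
open import Relation.Binary.PropositionalEquality
  using (refl; sym; trans; cong; cong₂; subst; module ≡-Reasoning)

half<self : ∀ n → suc n / 2 < suc n
half<self n = m/n<m (suc n) 2 (s≤s (s≤s z≤n))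

-- The digit function of binaryRep is private to Defs. binaryRep-suc is stated only so that,
-- once suc n / 2 and the accessibility proof are abstracted, unification solves
-- binaryDigits as exactly that function.
mutual
  binaryDigits : (m : ℕ) → Acc _<_ m → BitString
  binaryDigits = _

  binaryRep-suc : ∀ n → binaryRep (suc n) ≡
    (suc n % 2 ≡ᵇ 1) ∷ binaryDigits (suc n / 2)
      (Subrelation.accessible <⇒<′ (<′-wellFounded′ (suc n) (<⇒<′ (half<self n))))
  binaryRep-suc n with suc n / 2 | Subrelation.accessible <⇒<′ (<′-wellFounded′ (suc n) (<⇒<′ (half<self n)))
  ... | _ | _ = refl

bitVal-≡ᵇ1 : ∀ {r} → r < 2 → bitVal (r ≡ᵇ 1) ≡ r
bitVal-≡ᵇ1 {0}           _                = refl
bitVal-≡ᵇ1 {1}           _                = refl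
bitVal-≡ᵇ1 {suc (suc _)} (s≤s (s≤s ()))

bitVal≤1 : ∀ b → bitVal b ≤ 1
bitVal≤1 false = z≤n
bitVal≤1 true  = s≤s z≤n

intVal-binaryDigits : ∀ m (w : Acc _<_ m) → intVal (binaryDigits m w) ≡ m
intVal-binaryDigits zero    _        = refl
intVal-binaryDigits (suc n) (acc rs) = begin
  bitVal (suc n % 2 ≡ᵇ 1) + 2 * intVal (binaryDigits (suc n / 2) (rs (half<self n)))
    ≡⟨ cong₂ _+_ (bitVal-≡ᵇ1 (m%n<n (suc n) 2))
                 (cong (2 *_) (intVal-binaryDigits (suc n / 2) (rs (half<self n)))) ⟩
  suc n % 2 + 2 * (suc n / 2)  ≡⟨ cong (suc n % 2 +_) (*-comm 2 (suc n / 2)) ⟩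
  suc n % 2 + suc n / 2 * 2    ≡⟨ sym (m≡m%n+[m/n]*n (suc n) 2) ⟩
  suc n                        ∎
  where open ≡-Reasoning

length-binaryDigits≤ : ∀ {m} (w : Acc _<_ m) ℓ → m < 2 ^ ℓ → length (binaryDigits m w) ≤ ℓ
length-binaryDigits≤ {zero}  _        _       _            = z≤n
length-binaryDigits≤ {suc n} (acc rs) zero    (s≤s ())
length-binaryDigits≤ {suc n} (acc rs) (suc ℓ) m<2^[1+ℓ] =
  s≤s (length-binaryDigits≤ (rs (half<self n)) ℓ
        (m<n*o⇒m/o<n (subst (suc n <_) (*-comm 2 (2 ^ ℓ)) m<2^[1+ℓ])))

intVal-binaryRep : ∀ n → intVal (binaryRep n) ≡ n
intVal-binaryRep zero    = refl
intVal-binaryRep (suc n) = intVal-binaryDigits (suc n) (<-wellFounded (suc n))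

binaryRep-injective : ∀ {m n} → binaryRep m ≡ binaryRep n → m ≡ n
binaryRep-injective {m} {n} eq =
  trans (sym (intVal-binaryRep m)) (trans (cong intVal eq) (intVal-binaryRep n))

length-binaryRep≤ : ∀ {n ℓ} → 1 ≤ ℓ → n < 2 ^ ℓ → length (binaryRep n) ≤ ℓ
length-binaryRep≤ {zero}  1≤ℓ _     = 1≤ℓ
length-binaryRep≤ {suc n} _   small = length-binaryDigits≤ (<-wellFounded (suc n)) _ small

length-binaryRep-⊓≤ : ∀ {m n ℓ} → 1 ≤ ℓ → m ⊓ n < 2 ^ ℓ →
  length (binaryRep m) ⊓ length (binaryRep n) ≤ ℓ
length-binaryRep-⊓≤ {m} {n} 1≤ℓ small with ⊓-sel m n
... | inj₁ m⊓n≡m = ≤-trans (m⊓n≤m _ _) (length-binaryRep≤ 1≤ℓ (subst (_< _) m⊓n≡m small))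
... | inj₂ m⊓n≡n = ≤-trans (m⊓n≤n _ _) (length-binaryRep≤ 1≤ℓ (subst (_< _) m⊓n≡n small))

DiffWithin : BitString → BitString → ℕ → Set
DiffWithin xs ys k = ∃ λ i → firstDiff xs ys ≡ just i × i ≤ k

DiffWithin-∷ : ∀ b {xs ys k} → DiffWithin xs ys k → DiffWithin (b ∷ xs) (b ∷ ys) (suc k)
DiffWithin-∷ false (i , diff , i≤k) rewrite diff = suc i , refl , s≤s i≤k
DiffWithin-∷ true  (i , diff , i≤k) rewrite diff = suc i , refl , s≤s i≤k

DiffWithin-encodeSF-∷ : ∀ b {as bs k} → DiffWithin (encodeSF as) (encodeSF bs) (2 * k + 1) →
  DiffWithin (encodeSF (b ∷ as)) (encodeSF (b ∷ bs)) (2 * suc k + 1)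
DiffWithin-encodeSF-∷ b {as} {bs} {k} d =
  subst (DiffWithin (encodeSF (b ∷ as)) (encodeSF (b ∷ bs))) (cong (_+ 1) (sym (*-suc 2 k)))
    (DiffWithin-∷ (not b) {b ∷ encodeSF as} {b ∷ encodeSF bs} (DiffWithin-∷ b {encodeSF as} {encodeSF bs} d))

DiffWithin-encodeSF : ∀ {as bs} → as ≢ bs →
  DiffWithin (encodeSF as) (encodeSF bs) (2 * (length as ⊓ length bs) + 1)
DiffWithin-encodeSF {[]}         {[]}         as≢bs = ⊥-elim (as≢bs refl)
DiffWithin-encodeSF {[]}         {false ∷ _}  _     = 0 , refl , z≤n
DiffWithin-encodeSF {[]}         {true ∷ _}   _     = 1 , refl , s≤s z≤n
DiffWithin-encodeSF {false ∷ _}  {[]}         _     = 0 , refl , z≤n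
DiffWithin-encodeSF {true ∷ _}   {[]}         _     = 1 , refl , s≤s z≤n
DiffWithin-encodeSF {false ∷ _}  {true ∷ _}   _     = 0 , refl , z≤n
DiffWithin-encodeSF {true ∷ _}   {false ∷ _}  _     = 0 , refl , z≤n
DiffWithin-encodeSF {false ∷ as} {false ∷ bs} ne =
  DiffWithin-encodeSF-∷ false {as} {bs} (DiffWithin-encodeSF (ne ∘ cong (false ∷_)))
DiffWithin-encodeSF {true ∷ as}  {true ∷ bs}  ne =
  DiffWithin-encodeSF-∷ true {as} {bs} (DiffWithin-encodeSF (ne ∘ cong (true ∷_)))

firstDiff-bitAt : ∀ xs ys {i} → firstDiff xs ys ≡ just i → ∃ λ b → bitAt xs i ≡ just b
firstDiff-bitAt (x ∷ xs) (y ∷ ys) diff with eqBit x y | firstDiff xs ys in diff′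
firstDiff-bitAt (x ∷ xs) (y ∷ ys) refl | false | _      = x , refl
firstDiff-bitAt (x ∷ xs) (y ∷ ys) refl | true  | just _ = firstDiff-bitAt xs ys diff′

intVal-∷-binaryRep≤ : ∀ b {i ℓ} → i ≤ 2 * ℓ + 1 → intVal (b ∷ binaryRep i) ≤ 8 * ℓ + 3
intVal-∷-binaryRep≤ b {i} {ℓ} i≤ = begin
  bitVal b + 2 * intVal (binaryRep i)  ≡⟨ cong (λ k → bitVal b + 2 * k) (intVal-binaryRep i) ⟩
  bitVal b + 2 * i                     ≤⟨ +-mono-≤ (bitVal≤1 b) (*-monoʳ-≤ 2 i≤) ⟩
  1 + 2 * (2 * ℓ + 1)                  ≡⟨ solve (ℓ ∷ []) ⟩
  4 * ℓ + 3                            ≤⟨ +-monoˡ-≤ 3 (*-monoˡ-≤ ℓ {4} {8} (s≤s (s≤s (s≤s (s≤s z≤n))))) ⟩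
  8 * ℓ + 3                            ∎
  where open ≤-Reasoning

mainTheorem8 : (I₁ I₂ ℓmin : ℕ) → I₁ ≢ I₂ → 1 ≤ ℓmin → I₁ ⊓ I₂ < 2 ^ ℓmin →
    ∃ λ v → cvChoice I₁ I₂ ≡ just v × v ≤ 8 * ℓmin + 3
mainTheorem8 I₁ I₂ ℓ I₁≢I₂ 1≤ℓ small
  with DiffWithin-encodeSF {binaryRep I₁} {binaryRep I₂} (I₁≢I₂ ∘ binaryRep-injective)
... | i , diff , i≤ with firstDiff-bitAt (encodeSF (binaryRep I₁)) _ diff
... | b , bit rewrite diff | bit =
  intVal (b ∷ binaryRep i) , refl ,
  intVal-∷-binaryRep≤ b {i} {ℓ} (≤-trans i≤ (+-monoˡ-≤ 1 (*-monoʳ-≤ 2 (length-binaryRep-⊓≤ {I₁} {I₂} 1≤ℓ small))))
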